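{- Let $k\ge 4$ be an integer. If $\vec H$ is either an orientation of the cycle $C_k$, or the transitive tournament $\mathrm{TT}_k$ on $k$ vertices, or an anti-directed orientation of a graph $H$ with minimum degree $\delta(H)>1$, then $\vec H$ is $2$-Ramsey-avoidable.
   Context: An oriented graph $\vec H$ with underlying graph $H$ is $2$-Ramsey-avoidable if for all $e,f\in E(H)$, every orientation of $e$ and $f$ can be extended to an orientation of $H$ which contains no subdigraph isomorphic to $\vec H$ (i.e., which is not isomorphic to $\vec H$). An oriented graph is anti-directed if each vertex has either no in-neighbours or no out-neighbours. $\mathrm{TT}_k$ denotes the transitive tournament on $k$ vertices. -}

module Defs where

open import Data.Bool using (Bool; true; false; _∨_; _∧_)
open import Data.Nat using (ℕ; zero; suc; _≤_; _<ᵇ_; _≡ᵇ_)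
open import Data.Fin using (Fin; toℕ)
open import Data.List using (length; filterᵇ; allFin)
open import Data.Product using (_×_; Σ; ∃)
open import Data.Sum using (_⊎_)
open import Function.Bundles using (_↔_; Inverse)
open import Relation.Binary.PropositionalEquality using (_≡_)
open import Relation.Nullary using (¬_)

Graph : ℕ → Set
Graph n = Fin n → Fin n → Bool

IsSimple : ∀ {n} → Graph n → Set
IsSimple {n} G = (∀ u v → G u v ≡ G v u) × (∀ v → G v v ≡ false)

Digraph : ℕ → Set
Digraph n = Fin n → Fin n → Bool

IsOrientation : ∀ {n} → Graph n → Digraph n → Set
IsOrientation {n} G D =
  (∀ u v → D u v ≡ true → G u v ≡ true) ×
  (∀ u v → D u v ≡ true → D v u ≡ false) ×
  (∀ u v → G u v ≡ true → D u v ≡ true ⊎ D v u ≡ true)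

Isomorphic : ∀ {n} → Digraph n → Digraph n → Set
Isomorphic {n} D E =
  Σ (Fin n ↔ Fin n) λ σ → ∀ u v → D u v ≡ E (Inverse.to σ u) (Inverse.to σ v)

-- 2-Ramsey-avoidable: for all edges e = {a,b}, f = {c,d} of H and every
-- (consistent) orientation a→b, c→d of them, there is an orientation of H
-- extending it which is not isomorphic to the given orientation HD.
TwoRamseyAvoidable : ∀ {n} → Graph n → Digraph n → Set
TwoRamseyAvoidable {n} H HD =
  ∀ (a b c d : Fin n) → H a b ≡ true → H c d ≡ true →
  ¬ (a ≡ d × b ≡ c) →
  ∃ λ (D : Digraph n) →
    IsOrientation H D × D a b ≡ true × D c d ≡ true × ¬ Isomorphic D HD

AntiDirected : ∀ {n} → Digraph n → Set
AntiDirected {n} D = ∀ v → (∀ u → D u v ≡ false) ⊎ (∀ u → D v u ≡ false)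

degree : ∀ {n} → Graph n → Fin n → ℕ
degree {n} G v = length (filterᵇ (G v) (allFin n))

MinDegreeGt1 : ∀ {n} → Graph n → Set
MinDegreeGt1 {n} G = ∀ v → 2 ≤ degree G v

-- The cycle C_k on Fin k: i ~ i+1 (mod k).
cycleGraph : (k : ℕ) → Graph k
cycleGraph k u v =
  (suc (toℕ u) ≡ᵇ toℕ v) ∨ (suc (toℕ v) ≡ᵇ toℕ u) ∨
  ((toℕ u ≡ᵇ 0) ∧ (suc (toℕ v) ≡ᵇ k)) ∨ ((toℕ v ≡ᵇ 0) ∧ (suc (toℕ u) ≡ᵇ k))

completeGraph : (k : ℕ) → Graph k
completeGraph k u v = (toℕ u <ᵇ toℕ v) ∨ (toℕ v <ᵇ toℕ u)

TT : (k : ℕ) → Digraph k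
TT k u v = toℕ u <ᵇ toℕ v

-- Each part exhibits an isomorphism invariant separating a suitable extension
-- of the two prescribed arcs from the given orientation.
--
-- Anti-directed H⃗ with δ(H) ≥ 2: extend the arc a → b by a further edge at b
-- (at a, if that edge is the other prescribed one) to a directed path of
-- length 2, which no anti-directed digraph contains.
--
-- TT_k: close a → b to a directed triangle a → b → w → a through a vertex w
-- chosen to avoid the other prescribed arc; TT_k has no directed cycle.
--
-- C_k: an orientation of the cycle is one bit per edge (forwards or backwards),
-- and v is a source iff the edge {v, next v} is forwards and {prev v, v}
-- backwards.  The prescribed arcs fix at most two bits.  If they fix equal
-- values, the constant orientation has no source and flipping one free bit
-- creates one.  If they fix different values every orientation has a source;
-- a single forward edge gives exactly one, two far-apart forward edges give
-- two.  The latter is impossible only on C₄ with the fixed edges opposite,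
-- where the existence of a directed path of length 3 separates the candidates.

module Submission where

open import Defs
open import Data.Bool using (Bool; true; false; not; if_then_else_; _∧_; _∨_)
import Data.Bool.Properties as Bool
open import Data.Empty using (⊥; ⊥-elim)
open import Data.Fin using (Fin; zero; suc; toℕ; fromℕ; inject₁; lower₁)
open import Data.Fin.Properties
  using (_≟_; toℕ-injective; toℕ<n; toℕ-fromℕ; toℕ-lower₁; toℕ-inject₁-≢;
         inject₁-lower₁; lower₁-inject₁′; any?; all?; injective⇒≤)
open import Data.List using (List; []; _∷_; _++_; length; lookup; allFin; filter)
open import Data.List.Membership.Propositional using (_∈_; _∉_)
open import Data.List.Relation.Unary.All using (All; []; _∷_)
open import Data.List.Relation.Unary.All.Properties using (all-filter; All¬⇒¬Any)
open import Data.List.Relation.Unary.Any as Any using (here; there; index)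
open import Data.List.Relation.Unary.Any.Properties using (lookup-index)
open import Data.List.Relation.Unary.Unique.Propositional using (Unique)
open import Data.List.Relation.Unary.AllPairs using (_∷_)
open import Data.List.Relation.Unary.Unique.Propositional.Properties using (allFin⁺; filter⁺)
open import Data.Nat using (ℕ; zero; suc; _≤_; _<_; s≤s; z<s)
import Data.Nat.Properties as ℕ
open import Data.Product using (_×_; _,_; proj₁; proj₂; ∃; ∃₂)
open import Data.Product.Properties as Product using (,-injective)
open import Data.Sum as Sum using (_⊎_; inj₁; inj₂; [_,_]′)
open import Function using (id; _∘_; const; Equivalence)
open import Function.Bundles using (Inverse; Injection)
open import Function.Definitions using (Injective)
open import Function.Properties.Inverse using (↔-sym; ↔⇒↣)
open import Relation.Binary.PropositionalEquality
open import Relation.Binary using (tri<; tri≈; tri>)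
open import Relation.Nullary using (¬_; Dec; yes; no; does; ¬?; contradiction)
open import Relation.Nullary.Decidable
  using (_×-dec_; _⊎-dec_; dec-true; dec-false; decidable-stable; T?)

private
  variable
    n m : ℕ

witness : ∀ {a} {A : Set a} (a? : Dec A) → does a? ≡ true → A
witness (yes a) _  = a
witness (no _)  ()

_∈?_ : (i : Fin n) (xs : List (Fin n)) → Dec (i ∈ xs)
i ∈? xs = Any.any? (i ≟_) xs

∉-or-all∈ : (xs : List (Fin n)) → ∃ (_∉ xs) ⊎ (∀ i → i ∈ xs)
∉-or-all∈ xs with any? (λ i → ¬? (i ∈? xs))
... | yes i∉ = inj₁ i∉
... | no ¬i∉ = inj₂ λ i → decidable-stable (i ∈? xs) (λ i∉xs → ¬i∉ (i , i∉xs))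

all∈⇒≤length : {xs : List (Fin n)} → (∀ i → i ∈ xs) → n ≤ length xs
all∈⇒≤length {xs = xs} all∈ = injective⇒≤ index-injective
  where
  index-injective : Injective _≡_ _≡_ (index ∘ all∈)
  index-injective {i} {j} eq =
    trans (lookup-index (all∈ i)) (trans (cong (lookup xs) eq) (sym (lookup-index (all∈ j))))

fresh : (xs : List (Fin n)) → length xs < n → ∃ (_∉ xs)
fresh xs len<n =
  [ id , (λ all∈ → contradiction (all∈⇒≤length all∈) (ℕ.<⇒≱ len<n)) ]′ (∉-or-all∈ xs)

pigeonhole₂ : ∀ {a} {A : Set a} {p q u v w : A} → let P = p ∷ q ∷ [] in
  u ∈ P → v ∈ P → w ∈ P → u ≢ v → v ≢ w → u ≢ w → ⊥
pigeonhole₂ (here refl)         (here refl)         _                   u≢v _   _   = u≢v refl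
pigeonhole₂ (there (here refl)) (there (here refl)) _                   u≢v _   _   = u≢v refl
pigeonhole₂ (here refl)         (there (here refl)) (here refl)         _   _   u≢w = u≢w refl
pigeonhole₂ (here refl)         (there (here refl)) (there (here refl)) _   v≢w _   = v≢w refl
pigeonhole₂ (there (here refl)) (here refl)         (here refl)         _   v≢w _   = v≢w refl
pigeonhole₂ (there (here refl)) (here refl)         (there (here refl)) _   _   u≢w = u≢w refl

two-distinct : ∀ {a p} {A : Set a} {P : A → Set p} {xs : List A} →
  Unique xs → All P xs → 2 ≤ length xs → ∃₂ λ x y → x ≢ y × P x × P y
two-distinct ((x≢y ∷ _) ∷ _) (px ∷ py ∷ _) _         = _ , _ , x≢y , px , py
two-distinct _               (_ ∷ [])      (s≤s ())

-- Isomorphism invariants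

Isomorphic-sym : {D E : Digraph n} → Isomorphic D E → Isomorphic E D
Isomorphic-sym {D = D} {E} (σ , D≡E∘σ) = ↔-sym σ , λ u v → sym (begin
  D (from u) (from v)            ≡⟨ D≡E∘σ (from u) (from v) ⟩
  E (to (from u)) (to (from v))  ≡⟨ cong₂ E (strictlyInverseˡ u) (strictlyInverseˡ v) ⟩
  E u v                          ∎)
  where
  open Inverse σ
  open ≡-Reasoning

Invariant : (Digraph n → Set) → Set
Invariant {n} P = ∀ {D E : Digraph n} → Isomorphic D E → P D → P E

module _ {P : Digraph n → Set} (P-invariant : Invariant P) {D E : Digraph n} where

  distinguishes : P D → ¬ P E → ¬ Isomorphic D E
  distinguishes pD ¬pE iso = ¬pE (P-invariant {D} {E} iso pD)

  distinguishes′ : ¬ P D → P E → ¬ Isomorphic D E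
  distinguishes′ ¬pD pE iso = ¬pD (P-invariant {E} {D} (Isomorphic-sym iso) pE)

IsSource : Digraph n → Fin n → Set
IsSource {n} D v = ∀ (u : Fin n) → D u v ≡ false

HasSource : Digraph n → Set
HasSource D = ∃ (IsSource D)

HasTwoSources : Digraph n → Set
HasTwoSources D = ∃₂ λ u v → u ≢ v × IsSource D u × IsSource D v

WalkTo : Digraph n → ℕ → Fin n → Fin n → Set
WalkTo D zero    u v = u ≡ v
WalkTo D (suc ℓ) u v = ∃ λ w → D u w ≡ true × WalkTo D ℓ w v

HasWalk : ℕ → Digraph n → Set
HasWalk ℓ D = ∃₂ (WalkTo D ℓ)

HasClosedWalk : ℕ → Digraph n → Set
HasClosedWalk ℓ D = ∃ λ u → WalkTo D ℓ u u

isSource? : (D : Digraph n) → ∀ v → Dec (IsSource D v)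
isSource? D v = all? (λ u → D u v Bool.≟ false)

hasSource? : (D : Digraph n) → Dec (HasSource D)
hasSource? D = any? (isSource? D)

hasTwoSources? : (D : Digraph n) → Dec (HasTwoSources D)
hasTwoSources? D = any? λ u → any? λ v → ¬? (u ≟ v) ×-dec isSource? D u ×-dec isSource? D v

walkTo? : (D : Digraph n) → ∀ ℓ u v → Dec (WalkTo D ℓ u v)
walkTo? D zero    u v = u ≟ v
walkTo? D (suc ℓ) u v = any? λ w → (D u w Bool.≟ true) ×-dec walkTo? D ℓ w v

hasWalk? : ∀ ℓ (D : Digraph n) → Dec (HasWalk ℓ D)
hasWalk? ℓ D = any? λ u → any? λ v → walkTo? D ℓ u v

module _ {D E : Digraph n} (iso : Isomorphic D E) where
  open Inverse (proj₁ iso) using (to; from; strictlyInverseʳ)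

  isSource-transport : ∀ {v} → IsSource D v → IsSource E (to v)
  isSource-transport {v} src u = begin
    E u (to v)                ≡⟨ proj₂ (Isomorphic-sym {D = D} {E} iso) u (to v) ⟩
    D (from u) (from (to v))  ≡⟨ cong (D (from u)) (strictlyInverseʳ v) ⟩
    D (from u) v              ≡⟨ src (from u) ⟩
    false                     ∎
    where open ≡-Reasoning

  walkTo-transport : ∀ {ℓ u v} → WalkTo D ℓ u v → WalkTo E ℓ (to u) (to v)
  walkTo-transport {zero}  refl           = refl
  walkTo-transport {suc ℓ} {u} (w , uw , wv) =
    to w , trans (sym (proj₂ iso u w)) uw , walkTo-transport wv

hasSource-invariant : Invariant {n} HasSource
hasSource-invariant {D = D} {E} iso (v , src) = _ , isSource-transport {D = D} {E} iso src

hasTwoSources-invariant : Invariant {n} HasTwoSources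
hasTwoSources-invariant {D = D} {E} iso (u , v , u≢v , src-u , src-v) =
  _ , _ , u≢v ∘ Injection.injective (↔⇒↣ (proj₁ iso)) ,
  isSource-transport {D = D} {E} iso src-u , isSource-transport {D = D} {E} iso src-v

hasWalk-invariant : ∀ ℓ → Invariant {n} (HasWalk ℓ)
hasWalk-invariant ℓ {D} {E} iso (u , v , walk) = _ , _ , walkTo-transport {D = D} {E} iso walk

hasClosedWalk-invariant : ∀ ℓ → Invariant {n} (HasClosedWalk ℓ)
hasClosedWalk-invariant ℓ {D} {E} iso (u , walk) = _ , walkTo-transport {D = D} {E} iso walk

-- By definition, TT n u v = does (toℕ u ℕ.<? toℕ v).
TT-arc⇒< : {u v : Fin n} → TT n u v ≡ true → toℕ u < toℕ v
TT-arc⇒< {u = u} {v} = witness (toℕ u ℕ.<? toℕ v)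

<⇒TT-arc : {u v : Fin n} → toℕ u < toℕ v → TT n u v ≡ true
<⇒TT-arc {u = u} {v} = dec-true (toℕ u ℕ.<? toℕ v)

_≟₂_ : (p q : Fin n × Fin n) → Dec (p ≡ q)
_≟₂_ = Product.≡-dec _≟_ _≟_

-- orientBy, orientCycle and constExcept are opaque so that unification can
-- read their arguments off applications instead of unfolding them.
opaque
  orientBy : Graph n → List (Fin n × Fin n) → Digraph n
  orientBy {n} G [] u v = G u v ∧ TT n u v
  orientBy G ((x , y) ∷ L) u v with (u , v) ≟₂ (x , y) | (v , u) ≟₂ (x , y)
  ... | yes _ | _     = true
  ... | no _  | yes _ = false
  ... | no _  | no _  = orientBy G L u v

opaque
  unfolding orientBy

  orientBy-arc : {G : Graph n} (L₁ : List (Fin n × Fin n)) {L₂ : List (Fin n × Fin n)} {x y : Fin n} →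
    (y , x) ∉ L₁ → orientBy G (L₁ ++ (x , y) ∷ L₂) x y ≡ true
  orientBy-arc [] {x = x} {y} _ with (x , y) ≟₂ (x , y)
  ... | yes _ = refl
  ... | no xy≢xy = contradiction refl xy≢xy
  orientBy-arc ((x′ , y′) ∷ L₁) {x = x} {y} yx∉ with (x , y) ≟₂ (x′ , y′) | (y , x) ≟₂ (x′ , y′)
  ... | yes _ | _         = refl
  ... | no _  | yes yx≡p  = contradiction (here yx≡p) yx∉
  ... | no _  | no _      = orientBy-arc L₁ (yx∉ ∘ there)

edge⇒≢ : {G : Graph n} → IsSimple G → ∀ {u v} → G u v ≡ true → u ≢ v
edge⇒≢ (_ , G-loopless) {u} uv refl = contradiction (trans (sym uv) (G-loopless u)) λ ()

module _ {G : Graph n} (G-simple : IsSimple G) where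

  private
    Edges : List (Fin n × Fin n) → Set
    Edges = All λ (x , y) → G x y ≡ true

  opaque
    unfolding orientBy

    orientBy⇒edge : ∀ L → Edges L → ∀ u v → orientBy G L u v ≡ true → G u v ≡ true
    orientBy⇒edge [] _ u v arc = Bool.∧-conicalˡ _ _ arc
    orientBy⇒edge ((x , y) ∷ L) (xy ∷ edges) u v arc with (u , v) ≟₂ (x , y) | (v , u) ≟₂ (x , y)
    ... | yes refl | _        = xy
    ... | no _     | yes refl = trans (proj₁ G-simple u v) xy
    ... | no _     | no _     = orientBy⇒edge L edges u v arc

    orientBy-antisym : ∀ L → Edges L → ∀ u v → orientBy G L u v ≡ true → orientBy G L v u ≡ false
    orientBy-antisym [] _ u v arc =
      trans (cong (G v u ∧_) (dec-false (toℕ v ℕ.<? toℕ u) (ℕ.<-asym (TT-arc⇒< (Bool.∧-conicalʳ _ _ arc)))))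
            (Bool.∧-zeroʳ (G v u))
    orientBy-antisym ((x , y) ∷ L) (xy ∷ edges) u v arc
      with (u , v) ≟₂ (x , y) | (v , u) ≟₂ (x , y)
    ... | yes refl | yes vu≡xy = contradiction (proj₁ (,-injective vu≡xy)) (edge⇒≢ G-simple xy ∘ sym)
    ... | yes refl | no _      = refl
    ... | no _     | yes _     = contradiction arc λ ()
    ... | no _     | no _      = orientBy-antisym L edges u v arc

    orientBy-complete : ∀ L → Edges L → ∀ u v → G u v ≡ true →
      orientBy G L u v ≡ true ⊎ orientBy G L v u ≡ true
    orientBy-complete [] _ u v uv with ℕ.<-cmp (toℕ u) (toℕ v)
    ... | tri< u<v _ _ = inj₁ (cong₂ _∧_ uv (<⇒TT-arc u<v))
    ... | tri≈ _ u≡v _ = contradiction (toℕ-injective u≡v) (edge⇒≢ G-simple uv)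
    ... | tri> _ _ v<u = inj₂ (cong₂ _∧_ (trans (proj₁ G-simple v u) uv) (<⇒TT-arc v<u))
    orientBy-complete ((x , y) ∷ L) (xy ∷ edges) u v uv
      with (u , v) ≟₂ (x , y) | (v , u) ≟₂ (x , y)
    ... | yes _ | _     = inj₁ refl
    ... | no _  | yes _ = inj₂ refl
    ... | no _  | no _  = orientBy-complete L edges u v uv

    orientBy-isOrientation : ∀ L → Edges L → IsOrientation G (orientBy G L)
    orientBy-isOrientation L edges =
      orientBy⇒edge L edges , orientBy-antisym L edges , orientBy-complete L edges

¬opposite⇒≢ : {a b c d : Fin n} → ¬ (a ≡ d × b ≡ c) → (d , c) ≢ (a , b)
¬opposite⇒≢ ¬opposite dc≡ab = let (d≡a , c≡b) = ,-injective dc≡ab in ¬opposite (sym d≡a , sym c≡b)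

-- The cycle

next : Fin (suc m) → Fin (suc m)
next {m} i with m ℕ.≟ toℕ i
... | yes _   = zero
... | no m≢i  = suc (lower₁ i m≢i)

prev : Fin (suc m) → Fin (suc m)
prev zero    = fromℕ _
prev (suc i) = inject₁ i

next-prev : (i : Fin (suc m)) → next (prev i) ≡ i
next-prev {m} zero with m ℕ.≟ toℕ (fromℕ m)
... | yes _     = refl
... | no m≢last = contradiction (sym (toℕ-fromℕ m)) m≢last
next-prev {m} (suc i) with m ℕ.≟ toℕ (inject₁ i)
... | yes m≡i = contradiction m≡i (toℕ-inject₁-≢ i)
... | no m≢i  = cong suc (lower₁-inject₁′ i m≢i)

prev-next : (i : Fin (suc m)) → prev (next i) ≡ i
prev-next {m} i with m ℕ.≟ toℕ i
... | yes m≡i = toℕ-injective (trans (toℕ-fromℕ m) m≡i)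
... | no m≢i  = inject₁-lower₁ i m≢i

next-injective : Injective _≡_ _≡_ (next {m})
next-injective {x = i} {j} eq = trans (sym (prev-next i)) (trans (cong prev eq) (prev-next j))

CycleSucc : Fin (suc m) → Fin (suc m) → Set
CycleSucc {m} i j = suc (toℕ i) ≡ toℕ j ⊎ (toℕ j ≡ 0 × suc (toℕ i) ≡ suc m)

next-cycleSucc : (i : Fin (suc m)) → CycleSucc i (next i)
next-cycleSucc {m} i with m ℕ.≟ toℕ i
... | yes m≡i = inj₂ (refl , cong suc (sym m≡i))
... | no m≢i  = inj₁ (cong suc (sym (toℕ-lower₁ i m≢i)))

cycleSucc-next : {i j : Fin (suc m)} → CycleSucc i j → j ≡ next i
cycleSucc-next {m} {i} {j} (inj₁ i+1≡j) with m ℕ.≟ toℕ i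
... | yes m≡i = contradiction (toℕ<n j) (ℕ.<-irrefl (trans (sym i+1≡j) (cong suc (sym m≡i))))
... | no m≢i  = toℕ-injective (trans (sym i+1≡j) (cong suc (sym (toℕ-lower₁ i m≢i))))
cycleSucc-next {m} {i} {j} (inj₂ (j≡0 , i+1≡k)) with m ℕ.≟ toℕ i
... | yes _   = toℕ-injective j≡0
... | no m≢i  = contradiction (sym (ℕ.suc-injective i+1≡k)) m≢i

cycleSucc-irrefl : 1 ≤ m → {i : Fin (suc m)} → ¬ CycleSucc i i
cycleSucc-irrefl 1≤m (inj₁ i+1≡i)          = ℕ.1+n≢n i+1≡i
cycleSucc-irrefl 1≤m (inj₂ (i≡0 , i+1≡m+1)) =
  ℕ.<⇒≢ 1≤m (trans (sym i≡0) (ℕ.suc-injective i+1≡m+1))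

cycleSucc-asym : 2 ≤ m → {i j : Fin (suc m)} → CycleSucc i j → ¬ CycleSucc j i
cycleSucc-asym 2≤m {i} (inj₁ i+1≡j) (inj₁ j+1≡i) =
  ℕ.m≢1+n+m (toℕ i) {1} (sym (trans (cong suc i+1≡j) j+1≡i))
cycleSucc-asym 2≤m (inj₁ i+1≡j) (inj₂ (i≡0 , j+1≡m+1)) =
  ℕ.<⇒≢ 2≤m (trans (trans (sym (cong suc i≡0)) i+1≡j) (ℕ.suc-injective j+1≡m+1))
cycleSucc-asym 2≤m (inj₂ (j≡0 , i+1≡m+1)) (inj₁ j+1≡i) =
  ℕ.<⇒≢ 2≤m (trans (trans (sym (cong suc j≡0)) j+1≡i) (ℕ.suc-injective i+1≡m+1))
cycleSucc-asym 2≤m (inj₂ (j≡0 , _)) (inj₂ (_ , j+1≡m+1)) =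
  ℕ.<⇒≢ (ℕ.<-trans z<s 2≤m) (trans (sym j≡0) (ℕ.suc-injective j+1≡m+1))

next-≢ : 1 ≤ m → (i : Fin (suc m)) → next i ≢ i
next-≢ 1≤m i next-i≡i = cycleSucc-irrefl 1≤m (subst (CycleSucc i) next-i≡i (next-cycleSucc i))

next²-≢ : 2 ≤ m → (i : Fin (suc m)) → next (next i) ≢ i
next²-≢ 2≤m i next²-i≡i =
  cycleSucc-asym 2≤m (next-cycleSucc i) (subst (CycleSucc (next i)) next²-i≡i (next-cycleSucc (next i)))

prev-≢ : 1 ≤ m → (i : Fin (suc m)) → prev i ≢ i
prev-≢ 1≤m i prev-i≡i = next-≢ 1≤m (prev i) (trans (next-prev i) (sym prev-i≡i))

consecutive-pigeonhole : 2 ≤ m → {p q i : Fin (suc m)} → let P = p ∷ q ∷ [] in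
  i ∈ P → next i ∈ P → next (next i) ∈ P → ⊥
consecutive-pigeonhole 2≤m {i = i} i∈P ni∈P nni∈P =
  pigeonhole₂ i∈P ni∈P nni∈P (next-≢ 1≤m i ∘ sym) (next-≢ 1≤m (next i) ∘ sym) (next²-≢ 2≤m i ∘ sym)
  where 1≤m = ℕ.<⇒≤ 2≤m

private
  CycleAdjacent : Fin (suc m) → Fin (suc m) → Set
  CycleAdjacent {m} u v =
    suc (toℕ u) ≡ toℕ v ⊎ suc (toℕ v) ≡ toℕ u ⊎
    (toℕ u ≡ 0 × suc (toℕ v) ≡ suc m) ⊎ (toℕ v ≡ 0 × suc (toℕ u) ≡ suc m)

  -- cycleGraph (suc m) u v is by definition does (cycleAdjacent? u v).
  cycleAdjacent? : (u v : Fin (suc m)) → Dec (CycleAdjacent u v)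
  cycleAdjacent? {m} u v =
    (suc (toℕ u) ℕ.≟ toℕ v) ⊎-dec (suc (toℕ v) ℕ.≟ toℕ u) ⊎-dec
    ((toℕ u ℕ.≟ 0) ×-dec (suc (toℕ v) ℕ.≟ suc m)) ⊎-dec ((toℕ v ℕ.≟ 0) ×-dec (suc (toℕ u) ℕ.≟ suc m))

cycleGraph⇒next : (u v : Fin (suc m)) → cycleGraph (suc m) u v ≡ true → v ≡ next u ⊎ u ≡ next v
cycleGraph⇒next u v uv with witness (cycleAdjacent? u v) uv
... | inj₁ u+1≡v                  = inj₁ (cycleSucc-next (inj₁ u+1≡v))
... | inj₂ (inj₁ v+1≡u)           = inj₂ (cycleSucc-next (inj₁ v+1≡u))
... | inj₂ (inj₂ (inj₁ v-last))   = inj₂ (cycleSucc-next (inj₂ v-last))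
... | inj₂ (inj₂ (inj₂ u-last))   = inj₁ (cycleSucc-next (inj₂ u-last))

next⇒cycleGraph : {u v : Fin (suc m)} → v ≡ next u ⊎ u ≡ next v → cycleGraph (suc m) u v ≡ true
next⇒cycleGraph {u = u} {v} (inj₁ refl) with next-cycleSucc u
... | inj₁ u+1≡v = dec-true (cycleAdjacent? u v) (inj₁ u+1≡v)
... | inj₂ u-last = dec-true (cycleAdjacent? u v) (inj₂ (inj₂ (inj₂ u-last)))
next⇒cycleGraph {u = u} {v} (inj₂ refl) with next-cycleSucc v
... | inj₁ v+1≡u = dec-true (cycleAdjacent? u v) (inj₂ (inj₁ v+1≡u))
... | inj₂ v-last = dec-true (cycleAdjacent? u v) (inj₂ (inj₂ (inj₁ v-last)))

-- b i tells whether the edge {i , next i} is oriented from i to next i.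
CycleArc : (Fin (suc m) → Bool) → Fin (suc m) → Fin (suc m) → Set
CycleArc b u v = (v ≡ next u × b u ≡ true) ⊎ (u ≡ next v × b v ≡ false)

cycleArc? : (b : Fin (suc m) → Bool) → ∀ u v → Dec (CycleArc b u v)
cycleArc? b u v = (v ≟ next u ×-dec b u Bool.≟ true) ⊎-dec (u ≟ next v ×-dec b v Bool.≟ false)

opaque
  orientCycle : (Fin (suc m) → Bool) → Digraph (suc m)
  orientCycle b u v = does (cycleArc? b u v)

module _ {b : Fin (suc m) → Bool} where

  opaque
    unfolding orientCycle

    cycleArc⇒orientCycle : ∀ {u v} → CycleArc b u v → orientCycle b u v ≡ true
    cycleArc⇒orientCycle {u} {v} = dec-true (cycleArc? b u v)

    ¬cycleArc⇒orientCycle : ∀ {u v} → ¬ CycleArc b u v → orientCycle b u v ≡ false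
    ¬cycleArc⇒orientCycle {u} {v} = dec-false (cycleArc? b u v)

    orientCycle⇒cycleArc : ∀ {u v} → orientCycle b u v ≡ true → CycleArc b u v
    orientCycle⇒cycleArc {u} {v} = witness (cycleArc? b u v)

  cycleArc-asym : 2 ≤ m → ∀ {u v} → CycleArc b u v → ¬ CycleArc b v u
  cycleArc-asym 2≤m {u} (inj₁ (refl , _))  (inj₁ (u≡n²u , _)) = next²-≢ 2≤m u (sym u≡n²u)
  cycleArc-asym 2≤m     (inj₁ (_ , bu))    (inj₂ (_ , bu′))   = Bool.not-¬ bu bu′
  cycleArc-asym 2≤m     (inj₂ (_ , bv))    (inj₁ (_ , bv′))   = Bool.not-¬ bv′ bv
  cycleArc-asym 2≤m {v = v} (inj₂ (refl , _)) (inj₂ (v≡n²v , _)) = next²-≢ 2≤m v (sym v≡n²v)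

  cycleArc-oriented : ∀ {u v} → v ≡ next u → CycleArc b u v ⊎ CycleArc b v u
  cycleArc-oriented {u} v≡nu with b u Bool.≟ true
  ... | yes bu = inj₁ (inj₁ (v≡nu , bu))
  ... | no ¬bu = inj₂ (inj₂ (v≡nu , Bool.¬-not ¬bu))

  orientCycle-isOrientation : 2 ≤ m → IsOrientation (cycleGraph (suc m)) (orientCycle b)
  orientCycle-isOrientation 2≤m = arc⇒edge , antisym , complete
    where
    arc⇒edge : ∀ u v → orientCycle b u v ≡ true → cycleGraph (suc m) u v ≡ true
    arc⇒edge u v uv = next⇒cycleGraph ([ inj₁ ∘ proj₁ , inj₂ ∘ proj₁ ]′ (orientCycle⇒cycleArc uv))

    antisym : ∀ u v → orientCycle b u v ≡ true → orientCycle b v u ≡ false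
    antisym u v uv = ¬cycleArc⇒orientCycle (cycleArc-asym 2≤m (orientCycle⇒cycleArc uv))

    complete : ∀ u v → cycleGraph (suc m) u v ≡ true →
      orientCycle b u v ≡ true ⊎ orientCycle b v u ≡ true
    complete u v uv = Sum.map cycleArc⇒orientCycle cycleArc⇒orientCycle
      ([ cycleArc-oriented , Sum.swap ∘ cycleArc-oriented ]′ (cycleGraph⇒next u v uv))

  isSource⇒bits : ∀ {v} → IsSource (orientCycle b) v → b v ≡ true × b (prev v) ≡ false
  isSource⇒bits {v} src =
    Bool.¬-not {y = false} (λ bv → Bool.not-¬ (cycleArc⇒orientCycle (inj₂ (refl , bv))) (src (next v))) ,
    Bool.¬-not {y = true} (λ bpv → Bool.not-¬ (cycleArc⇒orientCycle (inj₁ (sym (next-prev v) , bpv))) (src (prev v)))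

  bits⇒isSource : ∀ {v} → b v ≡ true → b (prev v) ≡ false → IsSource (orientCycle b) v
  bits⇒isSource {v} bv bpv u = ¬cycleArc⇒orientCycle λ where
    (inj₁ (v≡nu , bu)) → Bool.not-¬ (subst (λ i → b i ≡ true) (sym (trans (cong prev v≡nu) (prev-next u))) bu) bpv
    (inj₂ (_ , bv′))   → Bool.not-¬ bv bv′

  private
    bits-differ⇒next≢ : ∀ {i j} → b i ≡ true → b j ≡ false → next i ≢ next j
    bits-differ⇒next≢ bi bj ni≡nj = Bool.not-¬ (subst (λ k → b k ≡ true) (next-injective ni≡nj) bi) bj

  walk3⇒threeInARow : HasWalk 3 (orientCycle b) → ∃₂ λ c i → b i ≡ c × b (next i) ≡ c × b (next (next i)) ≡ c
  walk3⇒threeInARow (u , _ , v , uv , w , vw , x , wx , refl)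
    with orientCycle⇒cycleArc uv | orientCycle⇒cycleArc vw | orientCycle⇒cycleArc wx
  ... | inj₁ (refl , bu) | inj₁ (refl , bv) | inj₁ (refl , bw) = true , u , bu , bv , bw
  ... | inj₂ (refl , bv) | inj₂ (refl , bw) | inj₂ (refl , bx) = false , x , bx , bw , bv
  ... | inj₁ (refl , bu) | inj₂ (nu≡nw , bw) | _                  = ⊥-elim (bits-differ⇒next≢ bu bw nu≡nw)
  ... | inj₂ (_ , bv)    | inj₁ (_ , bv′)    | _                  = ⊥-elim (Bool.not-¬ bv′ bv)
  ... | _                | inj₁ (refl , bv)  | inj₂ (nv≡nx , bx)  = ⊥-elim (bits-differ⇒next≢ bv bx nv≡nx)
  ... | _                | inj₂ (_ , bw)     | inj₁ (_ , bw′)     = ⊥-elim (Bool.not-¬ bw′ bw)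

  threeTrue⇒walk3 : ∀ i → b (prev i) ≡ true → b i ≡ true → b (next i) ≡ true → HasWalk 3 (orientCycle b)
  threeTrue⇒walk3 i bpi bi bni =
    prev i , _ ,
    i , cycleArc⇒orientCycle (inj₁ (sym (next-prev i) , bpi)) ,
    next i , cycleArc⇒orientCycle (inj₁ (refl , bi)) ,
    next (next i) , cycleArc⇒orientCycle (inj₁ (refl , bni)) , refl

opaque
  constExcept : Bool → List (Fin n) → Fin n → Bool
  constExcept s S i = if does (i ∈? S) then not s else s

module _ {s : Bool} {S : List (Fin n)} {i : Fin n} where
  opaque
    unfolding constExcept

    constExcept-∈ : i ∈ S → constExcept s S i ≡ not s
    constExcept-∈ i∈S with i ∈? S
    ... | yes _   = refl
    ... | no i∉S  = contradiction i∈S i∉S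

    constExcept-∉ : i ∉ S → constExcept s S i ≡ s
    constExcept-∉ i∉S with i ∈? S
    ... | yes i∈S = contradiction i∈S i∉S
    ... | no _    = refl

    constExcept-flipped⇒∈ : constExcept s S i ≡ not s → i ∈ S
    constExcept-flipped⇒∈ flipped with i ∈? S
    ... | yes i∈S = i∈S
    ... | no _    = contradiction flipped (Bool.not-¬ refl)

    constExcept-unflipped⇒∉ : constExcept s S i ≡ s → i ∉ S
    constExcept-unflipped⇒∉ unflipped with i ∈? S
    ... | yes _   = contradiction (sym unflipped) (Bool.not-¬ refl)
    ... | no i∉S  = i∉S

const-noSource : ∀ s → ¬ HasSource (orientCycle {m} (const s))
const-noSource s (v , src) = let (s≡true , s≡false) = isSource⇒bits src in Bool.not-¬ s≡true s≡false

constExcept-single-hasSource : 1 ≤ m → ∀ s (z : Fin (suc m)) → HasSource (orientCycle (constExcept s (z ∷ [])))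
constExcept-single-hasSource 1≤m false z =
  z , bits⇒isSource (constExcept-∈ (here refl)) (constExcept-∉ (All¬⇒¬Any (prev-≢ 1≤m z ∷ [])))
constExcept-single-hasSource 1≤m true z =
  next z , bits⇒isSource (constExcept-∉ (All¬⇒¬Any (next-≢ 1≤m z ∷ []))) (constExcept-∈ (here (prev-next z)))

AvoidingBits : Digraph (suc m) → Fin (suc m) → Bool → Fin (suc m) → Bool → Set
AvoidingBits D p s q t = ∃ λ b → b p ≡ s × b q ≡ t × ¬ Isomorphic (orientCycle b) D

avoidingBits-same : 2 ≤ m → (D : Digraph (suc m)) (p q : Fin (suc m)) (s : Bool) → AvoidingBits D p s q s
avoidingBits-same 2≤m D p q s with hasSource? D
... | yes src = const s , refl , refl , distinguishes′ hasSource-invariant (const-noSource s) src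
... | no ¬src with fresh (p ∷ q ∷ []) (s≤s 2≤m)
...   | z , z∉pq =
  constExcept s (z ∷ []) ,
  constExcept-∉ (All¬⇒¬Any ((z∉pq ∘ here ∘ sym) ∷ [])) ,
  constExcept-∉ (All¬⇒¬Any ((z∉pq ∘ there ∘ here ∘ sym) ∷ [])) ,
  distinguishes hasSource-invariant (constExcept-single-hasSource (ℕ.<⇒≤ 2≤m) s z) ¬src

falseExcept-single-noTwoSources : (x : Fin (suc m)) → ¬ HasTwoSources (orientCycle (constExcept false (x ∷ [])))
falseExcept-single-noTwoSources x (u , v , u≢v , src-u , src-v) = u≢v (trans (source≡x src-u) (sym (source≡x src-v)))
  where
  source≡x : ∀ {w} → IsSource (orientCycle (constExcept false (x ∷ []))) w → w ≡ x
  source≡x src with constExcept-flipped⇒∈ (proj₁ (isSource⇒bits src))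
  ... | here w≡x = w≡x

falseExcept-pair-twoSources : 1 ≤ m → {x z : Fin (suc m)} → z ≢ x → z ≢ next x → z ≢ prev x →
  HasTwoSources (orientCycle (constExcept false (x ∷ z ∷ [])))
falseExcept-pair-twoSources 1≤m {x} {z} z≢x z≢nx z≢px =
  x , z , z≢x ∘ sym ,
  bits⇒isSource (constExcept-∈ (here refl)) (constExcept-∉ (All¬⇒¬Any (prev-≢ 1≤m x ∷ (z≢px ∘ sym) ∷ []))) ,
  bits⇒isSource (constExcept-∈ (there (here refl))) (constExcept-∉ (All¬⇒¬Any (pz≢x ∷ prev-≢ 1≤m z ∷ [])))
  where
  pz≢x : prev z ≢ x
  pz≢x pz≡x = z≢nx (trans (sym (next-prev z)) (cong next pz≡x))

-- Here the cycle is C₄ with y opposite x; all four bit vectors with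
-- b x ≡ true and b y ≡ false have exactly one source.
module Square (3≤m : 3 ≤ m) {x y : Fin (suc m)} (cover : ∀ i → i ∈ x ∷ y ∷ next x ∷ prev x ∷ []) where

  private
    2≤m : 2 ≤ m
    2≤m = ℕ.<⇒≤ 3≤m

  y-opposite : y ∉ x ∷ next x ∷ prev x ∷ []
  y-opposite with fresh (x ∷ next x ∷ prev x ∷ []) (s≤s 3≤m)
  ... | w , w∉ with cover w
  ... | here w≡x                           = ⊥-elim (w∉ (here w≡x))
  ... | there (here refl)                  = w∉
  ... | there (there (here w≡nx))          = ⊥-elim (w∉ (there (here w≡nx)))
  ... | there (there (there (here w≡px)))  = ⊥-elim (w∉ (there (there (here w≡px))))

  falseExcept-adjacentPair-noWalk3 : ¬ HasWalk 3 (orientCycle (constExcept false (x ∷ next x ∷ [])))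
  falseExcept-adjacentPair-noWalk3 walk with walk3⇒threeInARow walk
  ... | true , i , bi , bni , bnni =
    consecutive-pigeonhole 2≤m (constExcept-flipped⇒∈ bi) (constExcept-flipped⇒∈ bni) (constExcept-flipped⇒∈ bnni)
  ... | false , i , bi , bni , bnni =
    consecutive-pigeonhole 2≤m (others (constExcept-unflipped⇒∉ bi)) (others (constExcept-unflipped⇒∉ bni))
      (others (constExcept-unflipped⇒∉ bnni))
    where
    others : ∀ {j} → j ∉ x ∷ next x ∷ [] → j ∈ y ∷ prev x ∷ []
    others {j} j∉ with cover j
    ... | here j≡x                          = ⊥-elim (j∉ (here j≡x))
    ... | there (here j≡y)                  = here j≡y
    ... | there (there (here j≡nx))         = ⊥-elim (j∉ (there (here j≡nx)))
    ... | there (there (there (here j≡px))) = there (here j≡px)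

  trueExcept-single-walk3 : HasWalk 3 (orientCycle (constExcept true (y ∷ [])))
  trueExcept-single-walk3 = threeTrue⇒walk3 x (unflipped (y∉ ∘ there ∘ there ∘ here ∘ sym))
    (unflipped (y∉ ∘ here ∘ sym)) (unflipped (y∉ ∘ there ∘ here ∘ sym))
    where
    y∉ = y-opposite
    unflipped : ∀ {j} → j ≢ y → constExcept true (y ∷ []) j ≡ true
    unflipped j≢y = constExcept-∉ (All¬⇒¬Any (j≢y ∷ []))

  avoidingBits-square : (D : Digraph (suc m)) → AvoidingBits D x true y false
  avoidingBits-square D with hasWalk? 3 D
  ... | yes walk =
    constExcept false (x ∷ next x ∷ []) , constExcept-∈ (here refl) ,
    constExcept-∉ (All¬⇒¬Any ((y-opposite ∘ here) ∷ (y-opposite ∘ there ∘ here) ∷ [])) ,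
    distinguishes′ (hasWalk-invariant 3) falseExcept-adjacentPair-noWalk3 walk
  ... | no ¬walk =
    constExcept true (y ∷ []) , constExcept-∉ (All¬⇒¬Any ((y-opposite ∘ here ∘ sym) ∷ [])) ,
    constExcept-∈ (here refl) , distinguishes (hasWalk-invariant 3) trueExcept-single-walk3 ¬walk

avoidingBits-different : 3 ≤ m → (D : Digraph (suc m)) (x y : Fin (suc m)) → x ≢ y →
  AvoidingBits D x true y false
avoidingBits-different 3≤m D x y x≢y
  with hasSource? D | hasTwoSources? D | ∉-or-all∈ (x ∷ y ∷ next x ∷ prev x ∷ [])
... | no ¬src | _ | _ =
  constExcept false (x ∷ []) , constExcept-∈ (here refl) , constExcept-∉ (All¬⇒¬Any ((x≢y ∘ sym) ∷ [])) ,
  distinguishes hasSource-invariant (constExcept-single-hasSource (ℕ.<⇒≤ (ℕ.<⇒≤ 3≤m)) false x) ¬src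
... | yes _ | yes two | _ =
  constExcept false (x ∷ []) , constExcept-∈ (here refl) , constExcept-∉ (All¬⇒¬Any ((x≢y ∘ sym) ∷ [])) ,
  distinguishes′ hasTwoSources-invariant (falseExcept-single-noTwoSources x) two
... | yes _ | no ¬two | inj₁ (z , z∉) =
  constExcept false (x ∷ z ∷ []) , constExcept-∈ (here refl) ,
  constExcept-∉ (All¬⇒¬Any ((x≢y ∘ sym) ∷ (z∉ ∘ there ∘ here ∘ sym) ∷ [])) ,
  distinguishes hasTwoSources-invariant
    (falseExcept-pair-twoSources (ℕ.<⇒≤ (ℕ.<⇒≤ 3≤m)) (z∉ ∘ here) (z∉ ∘ there ∘ there ∘ here) (z∉ ∘ there ∘ there ∘ there ∘ here))
    ¬two
... | yes _ | no _ | inj₂ cover = Square.avoidingBits-square 3≤m cover D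

avoidingBits : 3 ≤ m → (D : Digraph (suc m)) (p q : Fin (suc m)) (s t : Bool) → (p ≡ q → s ≡ t) →
  AvoidingBits D p s q t
avoidingBits 3≤m D p q false false _ = avoidingBits-same (ℕ.<⇒≤ 3≤m) D p q false
avoidingBits 3≤m D p q true  true  _ = avoidingBits-same (ℕ.<⇒≤ 3≤m) D p q true
avoidingBits 3≤m D p q true  false p≡q⇒ = avoidingBits-different 3≤m D p q (λ p≡q → contradiction (p≡q⇒ p≡q) λ ())
avoidingBits 3≤m D p q false true  p≡q⇒ with avoidingBits-different 3≤m D q p (λ q≡p → contradiction (p≡q⇒ (sym q≡p)) λ ())
... | b , bq , bp , ¬iso = b , bp , bq , ¬iso

data ArcBit {m} (u v : Fin (suc m)) : Fin (suc m) → Bool → Set where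
  forward  : v ≡ next u → ArcBit u v u true
  backward : u ≡ next v → ArcBit u v v false

cycleGraph⇒arcBit : (u v : Fin (suc m)) → cycleGraph (suc m) u v ≡ true → ∃₂ (ArcBit u v)
cycleGraph⇒arcBit u v uv = [ (λ v≡nu → u , true , forward v≡nu) , (λ u≡nv → v , false , backward u≡nv) ]′
  (cycleGraph⇒next u v uv)

arcBit-realised : ∀ {u v p s} {b : Fin (suc m) → Bool} → ArcBit u v p s → b p ≡ s → orientCycle b u v ≡ true
arcBit-realised (forward v≡nu)  bu = cycleArc⇒orientCycle (inj₁ (v≡nu , bu))
arcBit-realised (backward u≡nv) bv = cycleArc⇒orientCycle (inj₂ (u≡nv , bv))

arcBit-consistent : ∀ {a b c d p q : Fin (suc m)} {s t} → ¬ (a ≡ d × b ≡ c) →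
  ArcBit a b p s → ArcBit c d q t → p ≡ q → s ≡ t
arcBit-consistent _ (forward _) (forward _) _ = refl
arcBit-consistent _ (backward _) (backward _) _ = refl
arcBit-consistent ¬opposite (forward b≡na) (backward c≡nd) refl = contradiction (refl , trans b≡na (sym c≡nd)) ¬opposite
arcBit-consistent ¬opposite (backward a≡nb) (forward d≡nc) refl = contradiction (trans a≡nb (sym d≡nc) , refl) ¬opposite

cycle-avoidable : 3 ≤ m → (D : Digraph (suc m)) → TwoRamseyAvoidable (cycleGraph (suc m)) D
cycle-avoidable 3≤m D a b c d ab cd ¬opposite
  with cycleGraph⇒arcBit a b ab | cycleGraph⇒arcBit c d cd
... | p , s , ab-bit | q , t , cd-bit
  with avoidingBits 3≤m D p q s t (arcBit-consistent ¬opposite ab-bit cd-bit)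
... | bits , bp , bq , ¬iso =
  orientCycle bits , orientCycle-isOrientation (ℕ.<⇒≤ 3≤m) ,
  arcBit-realised ab-bit bp , arcBit-realised cd-bit bq , ¬iso

-- Transitive tournaments

TT-walk-increasing : ∀ ℓ {u v : Fin n} → WalkTo (TT n) (suc ℓ) u v → toℕ u < toℕ v
TT-walk-increasing zero    (_ , uw , refl) = TT-arc⇒< uw
TT-walk-increasing (suc ℓ) (_ , uw , wv)   = ℕ.<-trans (TT-arc⇒< uw) (TT-walk-increasing ℓ wv)

TT-noClosedWalk : ∀ ℓ → ¬ HasClosedWalk (suc ℓ) (TT n)
TT-noClosedWalk ℓ (u , walk) = ℕ.<-irrefl refl (TT-walk-increasing ℓ walk)

-- By definition, completeGraph n u v = TT n u v ∨ TT n v u.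
completeGraph-isSimple : IsSimple (completeGraph n)
completeGraph-isSimple {n} =
  (λ u v → Bool.∨-comm (TT n u v) (TT n v u)) ,
  (λ v → cong₂ _∨_ (TT-irrefl v) (TT-irrefl v))
  where
  TT-irrefl : ∀ v → TT n v v ≡ false
  TT-irrefl v = dec-false (toℕ v ℕ.<? toℕ v) (ℕ.<-irrefl refl)

≢⇒completeGraph : {u v : Fin n} → u ≢ v → completeGraph n u v ≡ true
≢⇒completeGraph {n} {u} {v} u≢v with ℕ.<-cmp (toℕ u) (toℕ v)
... | tri< u<v _ _ = cong (_∨ TT n v u) (<⇒TT-arc u<v)
... | tri≈ _ u≡v _ = contradiction (toℕ-injective u≡v) u≢v
... | tri> _ _ v<u = trans (Bool.∨-comm (TT n u v) (TT n v u)) (cong (_∨ TT n u v) (<⇒TT-arc v<u))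

triangleApex : 4 ≤ n → (a b c d : Fin n) →
  ∃ λ w → w ≢ a × w ≢ b × (w , b) ≢ (c , d) × (a , w) ≢ (c , d)
triangleApex 4≤n a b c d with a ≟ c
... | yes refl with fresh (a ∷ b ∷ d ∷ []) 4≤n
...   | w , w∉ = w , w∉ ∘ here , w∉ ∘ there ∘ here ,
                 w∉ ∘ here ∘ proj₁ ∘ ,-injective , w∉ ∘ there ∘ there ∘ here ∘ proj₂ ∘ ,-injective
triangleApex 4≤n a b c d | no a≢c with fresh (a ∷ b ∷ c ∷ []) 4≤n
...   | w , w∉ = w , w∉ ∘ here , w∉ ∘ there ∘ here ,
                 w∉ ∘ there ∘ there ∘ here ∘ proj₁ ∘ ,-injective , a≢c ∘ proj₁ ∘ ,-injective

TT-avoidable : 4 ≤ n → TwoRamseyAvoidable (completeGraph n) (TT n)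
TT-avoidable {n} 4≤n a b c d ab cd ¬opposite with triangleApex 4≤n a b c d
... | w , w≢a , w≢b , wb≢cd , aw≢cd =
  D , orientBy-isOrientation completeGraph-isSimple arcs (ab ∷ cd ∷ ≢⇒completeGraph (w≢b ∘ sym) ∷ ≢⇒completeGraph w≢a ∷ []) ,
  a→b , c→d ,
  distinguishes (hasClosedWalk-invariant 3) (a , b , a→b , w , b→w , a , w→a , refl) (TT-noClosedWalk 2)
  where
  arcs : List (Fin n × Fin n)
  arcs = (a , b) ∷ (c , d) ∷ (b , w) ∷ (w , a) ∷ []
  D : Digraph n
  D = orientBy (completeGraph n) arcs
  a→b : D a b ≡ true
  a→b = orientBy-arc [] λ ()
  c→d : D c d ≡ true
  c→d = orientBy-arc ((a , b) ∷ []) (All¬⇒¬Any (¬opposite⇒≢ ¬opposite ∷ []))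
  b→w : D b w ≡ true
  b→w = orientBy-arc ((a , b) ∷ (c , d) ∷ []) (All¬⇒¬Any ((w≢a ∘ proj₁ ∘ ,-injective) ∷ wb≢cd ∷ []))
  w→a : D w a ≡ true
  w→a = orientBy-arc ((a , b) ∷ (c , d) ∷ (b , w) ∷ [])
    (All¬⇒¬Any ((w≢b ∘ proj₂ ∘ ,-injective) ∷ aw≢cd ∷ (edge⇒≢ completeGraph-isSimple ab ∘ proj₁ ∘ ,-injective) ∷ []))

-- Anti-directed graphs

two-neighbours : {G : Graph n} {v : Fin n} → 2 ≤ degree G v →
  ∃₂ λ x y → x ≢ y × G v x ≡ true × G v y ≡ true
two-neighbours {n} {G} {v} 2≤deg
  with x , y , x≢y , vx , vy ← two-distinct (filter⁺ (T? ∘ G v) (allFin⁺ n)) (all-filter (T? ∘ G v) (allFin n)) 2≤deg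
  = x , y , x≢y , Equivalence.to Bool.T-≡ vx , Equivalence.to Bool.T-≡ vy

other-neighbour : {G : Graph n} → MinDegreeGt1 G → ∀ v a → ∃ λ w → G v w ≡ true × w ≢ a
other-neighbour {G = G} minDeg v a with two-neighbours {G = G} {v} (minDeg v)
... | x , y , x≢y , vx , vy with x ≟ a
... | yes x≡a = y , vy , λ y≡a → x≢y (trans x≡a (sym y≡a))
... | no x≢a  = x , vx , x≢a

antiDirected-noWalk2 : {D : Digraph n} → AntiDirected D → ¬ HasWalk 2 D
antiDirected-noWalk2 anti (u , _ , v , uv , w , vw , _) with anti v
... | inj₁ no-in  = Bool.not-¬ uv (no-in u)
... | inj₂ no-out = Bool.not-¬ vw (no-out w)

antiDirected-avoidable : {H : Graph n} {D : Digraph n} → IsSimple H → MinDegreeGt1 H → AntiDirected D →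
  TwoRamseyAvoidable H D
antiDirected-avoidable {n} {H} {D} simple@(H-sym , _) minDeg anti a b c d ab cd ¬opposite
  with other-neighbour minDeg b a
... | w , bw , w≢a with (c , d) ≟₂ (w , b)
...   | no cd≢wb =
  D′ , orientBy-isOrientation simple arcs (ab ∷ cd ∷ bw ∷ []) , a→b , c→d ,
  distinguishes (hasWalk-invariant 2) (a , w , b , a→b , w , b→w , refl) (antiDirected-noWalk2 anti)
  where
  arcs : List (Fin n × Fin n)
  arcs = (a , b) ∷ (c , d) ∷ (b , w) ∷ []
  D′ : Digraph n
  D′ = orientBy H arcs
  a→b : D′ a b ≡ true
  a→b = orientBy-arc [] λ ()
  c→d : D′ c d ≡ true
  c→d = orientBy-arc ((a , b) ∷ []) (All¬⇒¬Any (¬opposite⇒≢ ¬opposite ∷ []))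
  b→w : D′ b w ≡ true
  b→w = orientBy-arc ((a , b) ∷ (c , d) ∷ []) (All¬⇒¬Any ((w≢a ∘ proj₁ ∘ ,-injective) ∷ (cd≢wb ∘ sym) ∷ []))
...   | yes refl with w′ , aw′ , w′≢b ← other-neighbour minDeg a b =
  D′ , orientBy-isOrientation simple arcs (ab ∷ cd ∷ trans (H-sym w′ a) aw′ ∷ []) , a→b , w→b ,
  distinguishes (hasWalk-invariant 2) (w′ , b , a , w′→a , b , a→b , refl) (antiDirected-noWalk2 anti)
  where
  arcs : List (Fin n × Fin n)
  arcs = (a , b) ∷ (w , b) ∷ (w′ , a) ∷ []
  D′ : Digraph n
  D′ = orientBy H arcs
  a→b : D′ a b ≡ true
  a→b = orientBy-arc [] λ ()
  w→b : D′ w b ≡ true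
  w→b = orientBy-arc ((a , b) ∷ []) (All¬⇒¬Any ((edge⇒≢ simple ab ∘ sym ∘ proj₁ ∘ ,-injective) ∷ []))
  w′→a : D′ w′ a ≡ true
  w′→a = orientBy-arc ((a , b) ∷ (w , b) ∷ [])
    (All¬⇒¬Any ((w′≢b ∘ proj₂ ∘ ,-injective) ∷ (w′≢b ∘ proj₂ ∘ ,-injective) ∷ []))

mainTheorem2 : (k : ℕ) → 4 ≤ k →
    ((D : Digraph k) → IsOrientation (cycleGraph k) D → TwoRamseyAvoidable (cycleGraph k) D) ×
    TwoRamseyAvoidable (completeGraph k) (TT k) ×
    ((n : ℕ) (H : Graph n) (D : Digraph n) → IsSimple H → MinDegreeGt1 H →
      IsOrientation H D → AntiDirected D → TwoRamseyAvoidable H D)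
mainTheorem2 (suc m) 4≤k@(s≤s 3≤m) =
  (λ D _ → cycle-avoidable 3≤m D) ,
  TT-avoidable 4≤k ,
  λ _ _ _ simple minDeg _ anti → antiDirected-avoidable simple minDeg anti
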